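{- Let $q,a,u,v,x$ be indeterminates (generic parameters). For each integer $m\ge0$ define $H_m$ by $$\frac{(u;q)_m}{(q;q)_m}H_m=\sum_{i=0}^m a^{m-i}\frac{(u;q)_{m-i}}{(q;q)_{m-i}}\ {}_2\phi_1\!\left[\begin{matrix}q^{i-m},\ v\\ q^{1+i-m}/v\end{matrix};q,\frac{q}{v^2a^2}\right]\frac{(x;q)_i}{(q;q)_i}\,\frac{(uq^{m-i};q)_i}{(vq^{m-i+1};q)_i}\,\frac{(v^2q^{2m-i+1};q)_i}{(xv^2q^{2m-i};q)_i}.$$ Then for every integer $r\ge0$, $$a^r\frac{(u;q)_r}{(q;q)_r}\ {}_2\phi_1\!\left[\begin{matrix}q^{ -r},\ v\\ q^{1-r}/v\end{matrix};q,\frac{q}{v^2a^2}\right]=\sum_{i=0}^r\frac{(u;q)_{r-i}}{(q;q)_{r-i}}H_{r-i}\,x^i\,\frac{(1/x;q)_i}{(q;q)_i}\,\frac{(uq^{r-i};q)_i}{(vq^{r-i+1};q)_i}\,\frac{(v^2q^{2r-2i+1};q)_i}{(xv^2q^{2r-2i+1};q)_i}\,\frac{1-v^2q^{2r}}{1-v^2q^{2r-i}}.$$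
   Context: For an indeterminate $b$ and integer $k\ge 0$, $(b;q)_k=\prod_{j=0}^{k-1}(1-bq^j)$. The basic hypergeometric series is ${}_{2}\phi_1\!\left[\begin{matrix}a_1,a_2\\ b_1\end{matrix};q,z\right]=\sum_{i\ge0}\frac{(a_1;q)_i(a_2;q)_i}{(b_1;q)_i}\frac{z^i}{(q;q)_i}$, terminating when a numerator parameter is $q^{ -m}$, $m\ge0$ an integer. -}

module Defs where

open import Level using (Level; _⊔_) renaming (suc to lsuc)
open import Algebra.Bundles using (CommutativeRing)
open import Data.Nat using (ℕ; zero; suc; _∸_; _≤_) renaming (_+_ to _+ℕ_; _*_ to _*ℕ_)
open import Relation.Nullary using (¬_)

-- A field: a commutative ring with 0 ≠ 1 in which every nonzero element is
-- invertible.  The inverse is given as a total (congruent) operation whose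
-- value at 0 is unconstrained.
record Field (c ℓ : Level) : Set (lsuc (c ⊔ ℓ)) where
  field
    commutativeRing : CommutativeRing c ℓ
  open CommutativeRing commutativeRing public
  field
    _⁻¹        : Carrier → Carrier
    ⁻¹-cong    : ∀ {x y} → x ≈ y → (x ⁻¹) ≈ (y ⁻¹)
    0≉1        : ¬ (0# ≈ 1#)
    ⁻¹-inverse : ∀ x → ¬ (x ≈ 0#) → (x * (x ⁻¹)) ≈ 1#

module QSeries {c ℓ : Level} (F : Field c ℓ) where
  open Field F

  infixl 7 _/_
  _/_ : Carrier → Carrier → Carrier
  x / y = x * (y ⁻¹)

  infixr 8 _^_
  _^_ : Carrier → ℕ → Carrier
  x ^ zero  = 1#
  x ^ suc n = x * (x ^ n)

  sumTo : ℕ → (ℕ → Carrier) → Carrier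
  sumTo zero    f = f 0
  sumTo (suc n) f = sumTo n f + f (suc n)

  prodBelow : ℕ → (ℕ → Carrier) → Carrier
  prodBelow zero    f = 1#
  prodBelow (suc k) f = prodBelow k f * f k

  poch : (q b : Carrier) → ℕ → Carrier
  poch q b k = prodBelow k (λ j → 1# - b * q ^ j)

  qneg : Carrier → ℕ → Carrier
  qneg q n = (q ⁻¹) ^ n

  -- terminating 2φ1 [ q^{-n}, a₂ ; b₁ ; q, z ]  (the sum stops at i = n,
  -- since (q^{-n};q)_i = 0 for i > n)
  phi21 : (q : Carrier) (n : ℕ) (a₂ b₁ z : Carrier) → Carrier
  phi21 q n a₂ b₁ z =
    sumTo n (λ i → (poch q (qneg q n) i * poch q a₂ i) / poch q b₁ i
                     * (z ^ i / poch q q i))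

  Φ : (q a v : Carrier) (n : ℕ) → Carrier
  Φ q a v n = phi21 q n v (q * qneg q n / v) (q / (v ^ 2 * a ^ 2))

  S : (q a u v x : Carrier) (m : ℕ) → Carrier
  S q a u v x m =
    sumTo m (λ i →
      a ^ (m ∸ i) * (poch q u (m ∸ i) / poch q q (m ∸ i))
      * Φ q a v (m ∸ i)
      * (poch q x i / poch q q i)
      * (poch q (u * q ^ (m ∸ i)) i / poch q (v * q ^ (suc (m ∸ i))) i)
      * (poch q (v ^ 2 * q ^ suc ((2 *ℕ m) ∸ i)) i
          / poch q (x * v ^ 2 * q ^ ((2 *ℕ m) ∸ i)) i))

  H : (q a u v x : Carrier) (m : ℕ) → Carrier
  H q a u v x m = S q a u v x m / (poch q u m / poch q q m)

  -- Genericity of the parameters (all hold when q,a,u,v,x are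
  -- indeterminates, i.e. in the field ℚ(q,a,u,v,x)); they guarantee that
  -- every denominator occurring in the statement is nonzero.
  record Generic (q a u v x : Carrier) : Set ℓ where
    field
      q≉0   : ¬ (q ≈ 0#)
      a≉0   : ¬ (a ≈ 0#)
      v≉0   : ¬ (v ≈ 0#)
      x≉0   : ¬ (x ≈ 0#)
      qⁿ≉1  : ∀ n → ¬ (q ^ suc n ≈ 1#)
      uqⁿ   : ∀ n → ¬ (1# - u * q ^ n ≈ 0#)
      vqⁿ   : ∀ n → ¬ (1# - v * q ^ n ≈ 0#)
      v²qⁿ  : ∀ n → ¬ (1# - v ^ 2 * q ^ n ≈ 0#)
      xv²qⁿ : ∀ n → ¬ (1# - x * v ^ 2 * q ^ n ≈ 0#)

{-# OPTIONS --safe #-}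
module Submission where

-- Write A_m for the left-hand side at r = m and S_m = (u;q)_m/(q;q)_m H_m = Σ_k A_{m-k} C_{m,k}, with
-- lower-triangular coefficients C.  The right-hand side is Σ_i S_{r-i} D_{r,i}, so the identity holds for
-- any sequence A as soon as C and D are mutually inverse: Σ_{i≤s} C_{r-i,s-i} D_{r,i} = δ_{s0}.
-- Put j = r - s and w = v²q^{2j}.  In that sum the u- and v-Pochhammer symbols combine into a factor
-- independent of i, and what is left is the terminating well-poised sum
--   Σ_{i+t=n} x^i (1/x;q)_i/(q;q)_i · (x;q)_t/(q;q)_t · (wq^{t+1};q)_n (1-xwq^{2t})/(xwq^t;q)_{n+1}
--               · (1-wq^{2n})/(1-wq^{n+t}),
-- which vanishes for n ≥ 1 because it telescopes: multiplied by (1-q^n)(1-wq^n) its partial sums have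
-- a closed form, and the difference of two consecutive ones reduces to a polynomial identity in
-- x, w, q^p and q^{t+1}.

open import Defs
open import Level using (Level)
open import Algebra.Bundles using (CommutativeRing)
open import Data.Nat as ℕ using (ℕ; zero; suc; _∸_; _≤_; _<_; z≤n; s≤s) renaming (_+_ to _+ℕ_; _*_ to _*ℕ_)
import Data.Nat.Properties as ℕ
open import Data.Nat.Tactic.RingSolver using (solve-∀)
open import Data.Integer as ℤ using (ℤ; +_; -[1+_]; _⊖_; sign; ∣_∣)
import Data.Integer.Properties as ℤ
open import Data.Sign as Sign using (Sign)
open import Data.Maybe using (Maybe; just; nothing)
open import Relation.Nullary using (¬_; yes; no)
import Relation.Binary.PropositionalEquality as ≡

-- Tactic.RingSolver takes its coefficients in the ring itself and so cannot see that 1# - 1# vanishes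
-- in an abstract ring; this solver has integer coefficients, interpreted by the canonical map ℤ → R.
module IntegerRingSolver {c ℓ} (R : CommutativeRing c ℓ) where
  open CommutativeRing R
  open import Algebra.Properties.Ring ring using (-0#≈0#; -‿involutive; -‿+-comm; -1*x≈-x)
  open import Algebra.Properties.Semiring.Mult.TCOptimised semiring using (_×_; ×-homo-+; 1+×; ×1-homo-*)
  open import Algebra.Properties.CommutativeSemigroup *-commutativeSemigroup using (interchange)
  import Algebra.Properties.CommutativeSemigroup +-commutativeSemigroup as +-Semigroup
  import Algebra.Solver.Ring.AlmostCommutativeRing as ACR
  open import Relation.Binary.Reasoning.Setoid setoid

  ⟦_⟧ : ℤ → Carrier
  ⟦ + n ⟧      = n × 1#
  ⟦ -[1+ n ] ⟧ = - (suc n × 1#)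

  ⟦-⟧ : ∀ i → ⟦ ℤ.- i ⟧ ≈ - ⟦ i ⟧
  ⟦-⟧ (+ zero)   = sym -0#≈0#
  ⟦-⟧ (+ suc n)  = refl
  ⟦-⟧ -[1+ n ]   = sym (-‿involutive _)

  ⟦⊖⟧ : ∀ m n → ⟦ m ⊖ n ⟧ ≈ m × 1# - n × 1#
  ⟦⊖⟧ m       zero    = sym (trans (+-congˡ -0#≈0#) (+-identityʳ _))
  ⟦⊖⟧ zero    (suc n) = sym (+-identityˡ _)
  ⟦⊖⟧ (suc m) (suc n) = begin
    ⟦ suc m ⊖ suc n ⟧                   ≡⟨ ≡.cong ⟦_⟧ (ℤ.[1+m]⊖[1+n]≡m⊖n m n) ⟩
    ⟦ m ⊖ n ⟧                           ≈⟨ ⟦⊖⟧ m n ⟩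
    m × 1# - n × 1#                     ≈⟨ +-identityˡ _ ⟨
    0# + (m × 1# - n × 1#)              ≈⟨ +-congʳ (-‿inverseʳ 1#) ⟨
    (1# - 1#) + (m × 1# - n × 1#)       ≈⟨ +-Semigroup.interchange _ _ _ _ ⟩
    (1# + m × 1#) + (- 1# + - (n × 1#)) ≈⟨ +-cong (1+× m 1#) (trans (-‿cong (1+× n 1#)) (sym (-‿+-comm _ _))) ⟨
    suc m × 1# - suc n × 1#             ∎

  ⟦+⟧ : ∀ i j → ⟦ i ℤ.+ j ⟧ ≈ ⟦ i ⟧ + ⟦ j ⟧
  ⟦+⟧ (+ m)    (+ n)    = ×-homo-+ 1# m n
  ⟦+⟧ (+ m)    -[1+ n ] = ⟦⊖⟧ m (suc n)
  ⟦+⟧ -[1+ m ] (+ n)    = trans (⟦⊖⟧ n (suc m)) (+-comm _ _)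
  ⟦+⟧ -[1+ m ] -[1+ n ] = begin
    - (suc (suc (m +ℕ n)) × 1#)          ≡⟨ ≡.cong (λ k → - (suc k × 1#)) (ℕ.+-suc m n) ⟨
    - ((suc m +ℕ suc n) × 1#)            ≈⟨ -‿cong (×-homo-+ 1# (suc m) (suc n)) ⟩
    - (suc m × 1# + suc n × 1#)           ≈⟨ -‿+-comm _ _ ⟨
    - (suc m × 1#) + - (suc n × 1#)       ∎

  σ : Sign → Carrier
  σ Sign.+ = 1#
  σ Sign.- = - 1#

  σ-* : ∀ s t → σ (s Sign.* t) ≈ σ s * σ t
  σ-* Sign.+ t      = sym (*-identityˡ _)
  σ-* Sign.- Sign.+ = sym (*-identityʳ _)
  σ-* Sign.- Sign.- = sym (trans (-1*x≈-x _) (-‿involutive _))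

  ⟦◃⟧ : ∀ s n → ⟦ s ℤ.◃ n ⟧ ≈ σ s * n × 1#
  ⟦◃⟧ s      zero    = sym (zeroʳ _)
  ⟦◃⟧ Sign.+ (suc n) = sym (*-identityˡ _)
  ⟦◃⟧ Sign.- (suc n) = sym (-1*x≈-x _)

  ⟦⟧≈sign*abs : ∀ i → ⟦ i ⟧ ≈ σ (sign i) * ∣ i ∣ × 1#
  ⟦⟧≈sign*abs (+ n)    = sym (*-identityˡ _)
  ⟦⟧≈sign*abs -[1+ n ] = sym (-1*x≈-x _)

  ⟦*⟧ : ∀ i j → ⟦ i ℤ.* j ⟧ ≈ ⟦ i ⟧ * ⟦ j ⟧
  ⟦*⟧ i j = begin
    ⟦ (s Sign.* t) ℤ.◃ (m *ℕ n) ⟧   ≈⟨ ⟦◃⟧ (s Sign.* t) (m *ℕ n) ⟩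
    σ (s Sign.* t) * (m *ℕ n) × 1#  ≈⟨ *-cong (σ-* s t) (×1-homo-* m n) ⟩
    σ s * σ t * (m × 1# * n × 1#)   ≈⟨ interchange _ _ _ _ ⟩
    σ s * m × 1# * (σ t * n × 1#)   ≈⟨ *-cong (⟦⟧≈sign*abs i) (⟦⟧≈sign*abs j) ⟨
    ⟦ i ⟧ * ⟦ j ⟧                   ∎
    where
    s t : Sign
    s = sign i
    t = sign j
    m n : ℕ
    m = ∣ i ∣
    n = ∣ j ∣

  ℤ-morphism : ACR._-Raw-AlmostCommutative⟶_ ℤ.+-*-rawRing (ACR.fromCommutativeRing R)
  ℤ-morphism = record
    { ⟦_⟧ = ⟦_⟧ ; +-homo = ⟦+⟧ ; *-homo = ⟦*⟧ ; -‿homo = ⟦-⟧ ; 0-homo = refl ; 1-homo = refl }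

  ⟦⟧-≟ : ∀ i j → Maybe (⟦ i ⟧ ≈ ⟦ j ⟧)
  ⟦⟧-≟ i j with i ℤ.≟ j
  ... | yes ≡.refl = just refl
  ... | no _       = nothing

  open import Algebra.Solver.Ring ℤ.+-*-rawRing (ACR.fromCommutativeRing R) ℤ-morphism ⟦⟧-≟ public
    using (Polynomial; solve; _:=_; con; _:+_; _:*_; _:-_; :-_)

  𝟎 𝟏 : ∀ {n} → Polynomial n
  𝟎 = con (+ 0)
  𝟏 = con (+ 1)

module FieldProperties {c ℓ} (F : Field c ℓ) where
  open Field F
  open QSeries F using (_/_)
  open import Algebra.Properties.Ring ring using (x∙y⁻¹≈ε⇒x≈y)
  open import Algebra.Properties.CommutativeSemigroup *-commutativeSemigroup using (interchange)
  open import Relation.Binary.Reasoning.Setoid setoid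

  ⁻¹-inverseˡ : ∀ x → ¬ x ≈ 0# → x ⁻¹ * x ≈ 1#
  ⁻¹-inverseˡ x x≉0 = trans (*-comm _ _) (⁻¹-inverse x x≉0)

  ⁻¹-cancelˡ : ∀ {x} y → ¬ x ≈ 0# → x ⁻¹ * (x * y) ≈ y
  ⁻¹-cancelˡ {x} y x≉0 = begin
    x ⁻¹ * (x * y) ≈⟨ *-assoc _ _ _ ⟨
    x ⁻¹ * x * y   ≈⟨ *-congʳ (⁻¹-inverseˡ x x≉0) ⟩
    1# * y         ≈⟨ *-identityˡ y ⟩
    y              ∎

  x*y≈0⇒y≈0 : ∀ {x y} → ¬ x ≈ 0# → x * y ≈ 0# → y ≈ 0#
  x*y≈0⇒y≈0 {x} {y} x≉0 xy≈0 = begin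
    y              ≈⟨ ⁻¹-cancelˡ y x≉0 ⟨
    x ⁻¹ * (x * y) ≈⟨ *-congˡ xy≈0 ⟩
    x ⁻¹ * 0#      ≈⟨ zeroʳ _ ⟩
    0#             ∎

  x*y≉0 : ∀ {x y} → ¬ x ≈ 0# → ¬ y ≈ 0# → ¬ x * y ≈ 0#
  x*y≉0 x≉0 y≉0 xy≈0 = y≉0 (x*y≈0⇒y≈0 x≉0 xy≈0)

  ≉0-resp-≈ : ∀ {x y} → x ≈ y → ¬ x ≈ 0# → ¬ y ≈ 0#
  ≉0-resp-≈ x≈y x≉0 y≈0 = x≉0 (trans x≈y y≈0)

  1-x≈0⇒x≈1 : ∀ {x} → 1# - x ≈ 0# → x ≈ 1#
  1-x≈0⇒x≈1 1-x≈0 = sym (x∙y⁻¹≈ε⇒x≈y _ _ 1-x≈0)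

  ⁻¹-unique : ∀ {x y} → ¬ x ≈ 0# → x * y ≈ 1# → y ≈ x ⁻¹
  ⁻¹-unique {x} {y} x≉0 xy≈1 = begin
    y              ≈⟨ ⁻¹-cancelˡ y x≉0 ⟨
    x ⁻¹ * (x * y) ≈⟨ *-congˡ xy≈1 ⟩
    x ⁻¹ * 1#      ≈⟨ *-identityʳ _ ⟩
    x ⁻¹           ∎

  x⁻¹≉0 : ∀ {x} → ¬ x ≈ 0# → ¬ x ⁻¹ ≈ 0#
  x⁻¹≉0 {x} x≉0 x⁻¹≈0 = 0≉1 (begin
    0#         ≈⟨ zeroʳ x ⟨
    x * 0#     ≈⟨ *-congˡ x⁻¹≈0 ⟨
    x * x ⁻¹   ≈⟨ ⁻¹-inverse x x≉0 ⟩
    1#         ∎)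

  1⁻¹≈1 : 1# ⁻¹ ≈ 1#
  1⁻¹≈1 = sym (⁻¹-unique (λ 1≈0 → 0≉1 (sym 1≈0)) (*-identityˡ 1#))

  ⁻¹-distrib-* : ∀ {x y} → ¬ x ≈ 0# → ¬ y ≈ 0# → (x * y) ⁻¹ ≈ x ⁻¹ * y ⁻¹
  ⁻¹-distrib-* {x} {y} x≉0 y≉0 = sym (⁻¹-unique (x*y≉0 x≉0 y≉0) (begin
    x * y * (x ⁻¹ * y ⁻¹)     ≈⟨ interchange _ _ _ _ ⟩
    x * x ⁻¹ * (y * y ⁻¹)     ≈⟨ *-cong (⁻¹-inverse x x≉0) (⁻¹-inverse y y≉0) ⟩
    1# * 1#                   ≈⟨ *-identityʳ 1# ⟩
    1#                        ∎))

  x*[y/x]≈y : ∀ {x} y → ¬ x ≈ 0# → x * (y / x) ≈ y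
  x*[y/x]≈y {x} y x≉0 = begin
    x * (y * x ⁻¹) ≈⟨ *-congˡ (*-comm _ _) ⟩
    x * (x ⁻¹ * y) ≈⟨ *-assoc _ _ _ ⟨
    x * x ⁻¹ * y   ≈⟨ *-congʳ (⁻¹-inverse x x≉0) ⟩
    1# * y         ≈⟨ *-identityˡ y ⟩
    y              ∎

  x*y≈z⇒x≈z/y : ∀ {x y z} → ¬ y ≈ 0# → x * y ≈ z → x ≈ z / y
  x*y≈z⇒x≈z/y {x} {y} {z} y≉0 xy≈z = begin
    x              ≈⟨ ⁻¹-cancelˡ x y≉0 ⟨
    y ⁻¹ * (y * x) ≈⟨ *-congˡ (trans (*-comm _ _) xy≈z) ⟩
    y ⁻¹ * z       ≈⟨ *-comm _ _ ⟩
    z / y          ∎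

  x*y≈z⇒x⁻¹≈y/z : ∀ {x y z} → ¬ x ≈ 0# → ¬ y ≈ 0# → x * y ≈ z → x ⁻¹ ≈ y / z
  x*y≈z⇒x⁻¹≈y/z {x} {y} {z} x≉0 y≉0 xy≈z = begin
    x ⁻¹                  ≈⟨ ⁻¹-cancelˡ (x ⁻¹) y≉0 ⟨
    y ⁻¹ * (y * x ⁻¹)     ≈⟨ *-comm _ _ ⟩
    y * x ⁻¹ * y ⁻¹       ≈⟨ *-assoc _ _ _ ⟩
    y * (x ⁻¹ * y ⁻¹)     ≈⟨ *-congˡ (⁻¹-distrib-* x≉0 y≉0) ⟨
    y * (x * y) ⁻¹        ≈⟨ *-congˡ (⁻¹-cong xy≈z) ⟩
    y / z                 ∎

  /-*-/ : ∀ {b d} a c → ¬ b ≈ 0# → ¬ d ≈ 0# → a / b * (c / d) ≈ (a * c) / (b * d)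
  /-*-/ {b} {d} a c b≉0 d≉0 = begin
    a * b ⁻¹ * (c * d ⁻¹) ≈⟨ interchange _ _ _ _ ⟩
    a * c * (b ⁻¹ * d ⁻¹) ≈⟨ *-congˡ (⁻¹-distrib-* b≉0 d≉0) ⟨
    a * c * (b * d) ⁻¹    ∎

  x≈y*z+w⇒x/z≈y+w/z : ∀ {x y z w} → ¬ z ≈ 0# → x ≈ y * z + w → x / z ≈ y + w / z
  x≈y*z+w⇒x/z≈y+w/z {x} {y} {z} {w} z≉0 x≈yz+w = begin
    x * z ⁻¹                  ≈⟨ *-congʳ x≈yz+w ⟩
    (y * z + w) * z ⁻¹        ≈⟨ distribʳ _ _ _ ⟩
    y * z * z ⁻¹ + w * z ⁻¹   ≈⟨ +-congʳ (*-assoc _ _ _) ⟩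
    y * (z * z ⁻¹) + w / z    ≈⟨ +-congʳ (*-congˡ (⁻¹-inverse z z≉0)) ⟩
    y * 1# + w / z            ≈⟨ +-congʳ (*-identityʳ y) ⟩
    y + w / z                 ∎

module SumProperties {c ℓ} (F : Field c ℓ) where
  open Field F
  open QSeries F using (sumTo)
  open import Algebra.Properties.CommutativeSemigroup +-commutativeSemigroup using (interchange)
  open import Relation.Binary.Reasoning.Setoid setoid

  sumTo-cong : ∀ n {f g : ℕ → Carrier} → (∀ i → i ≤ n → f i ≈ g i) → sumTo n f ≈ sumTo n g
  sumTo-cong zero    f≈g = f≈g 0 z≤n
  sumTo-cong (suc n) f≈g = +-cong (sumTo-cong n (λ i i≤n → f≈g i (ℕ.m≤n⇒m≤1+n i≤n))) (f≈g (suc n) ℕ.≤-refl)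

  sumTo-+ : ∀ n (f g : ℕ → Carrier) → sumTo n (λ i → f i + g i) ≈ sumTo n f + sumTo n g
  sumTo-+ zero    f g = refl
  sumTo-+ (suc n) f g = trans (+-congʳ (sumTo-+ n f g)) (interchange _ _ _ _)

  *-distribˡ-sumTo : ∀ n x (f : ℕ → Carrier) → x * sumTo n f ≈ sumTo n (λ i → x * f i)
  *-distribˡ-sumTo zero    x f = refl
  *-distribˡ-sumTo (suc n) x f = trans (distribˡ _ _ _) (+-congʳ (*-distribˡ-sumTo n x f))

  *-distribʳ-sumTo : ∀ n x (f : ℕ → Carrier) → sumTo n f * x ≈ sumTo n (λ i → f i * x)
  *-distribʳ-sumTo zero    x f = refl
  *-distribʳ-sumTo (suc n) x f = trans (distribʳ _ _ _) (+-congʳ (*-distribʳ-sumTo n x f))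

  sumTo≈head : ∀ n (f : ℕ → Carrier) → (∀ i → 1 ≤ i → i ≤ n → f i ≈ 0#) → sumTo n f ≈ f 0
  sumTo≈head zero    f f≈0 = refl
  sumTo≈head (suc n) f f≈0 = begin
    sumTo n f + f (suc n) ≈⟨ +-cong (sumTo≈head n f (λ i 1≤i i≤n → f≈0 i 1≤i (ℕ.m≤n⇒m≤1+n i≤n)))
                                    (f≈0 (suc n) (s≤s z≤n) ℕ.≤-refl) ⟩
    f 0 + 0#              ≈⟨ +-identityʳ _ ⟩
    f 0                   ∎

  sumTo-telescope : ∀ {n} (f g : ℕ → Carrier) → f 0 ≈ 0# → (∀ p → p < n → f (suc p) ≈ f p + g p) →
                    ∀ p → p < n → sumTo p g ≈ f (suc p)
  sumTo-telescope f g f0≈0 step zero    0<n = sym (begin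
    f 1        ≈⟨ step 0 0<n ⟩
    f 0 + g 0  ≈⟨ +-congʳ f0≈0 ⟩
    0# + g 0   ≈⟨ +-identityˡ _ ⟩
    g 0        ∎)
  sumTo-telescope f g f0≈0 step (suc p) p<n = begin
    sumTo p g + g (suc p)   ≈⟨ +-congʳ (sumTo-telescope f g f0≈0 step p (ℕ.<-trans (ℕ.n<1+n p) p<n)) ⟩
    f (suc p) + g (suc p)   ≈⟨ step (suc p) p<n ⟨
    f (suc (suc p))         ∎

  sumTo-triangle : ∀ r (g : ℕ → ℕ → Carrier) →
    sumTo r (λ i → sumTo (r ∸ i) (g i)) ≈ sumTo r (λ s → sumTo s (λ i → g i (s ∸ i)))
  sumTo-triangle zero    g = refl
  sumTo-triangle (suc r) g = begin
    sumTo r (λ i → sumTo (suc r ∸ i) (g i)) + sumTo (r ∸ r) (g (suc r))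
      ≈⟨ +-cong (sumTo-cong r split-last) (reflexive (≡.cong (λ k → sumTo k (g (suc r))) (ℕ.n∸n≡0 r))) ⟩
    sumTo r (λ i → sumTo (r ∸ i) (g i) + g i (suc r ∸ i)) + g (suc r) 0
      ≈⟨ +-congʳ (sumTo-+ r _ _) ⟩
    sumTo r (λ i → sumTo (r ∸ i) (g i)) + sumTo r (λ i → g i (suc r ∸ i)) + g (suc r) 0
      ≈⟨ +-assoc _ _ _ ⟩
    sumTo r (λ i → sumTo (r ∸ i) (g i)) + (sumTo r (λ i → g i (suc r ∸ i)) + g (suc r) 0)
      ≈⟨ +-cong (sumTo-triangle r g) (+-congˡ (reflexive (≡.cong (g (suc r)) (≡.sym (ℕ.n∸n≡0 r))))) ⟩
    sumTo r (λ s → sumTo s (λ i → g i (s ∸ i))) + sumTo (suc r) (λ i → g i (suc r ∸ i))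
      ∎
    where
    split-last : ∀ i → i ≤ r → sumTo (suc r ∸ i) (g i) ≈ sumTo (r ∸ i) (g i) + g i (suc r ∸ i)
    split-last i i≤r rewrite ℕ.+-∸-assoc 1 i≤r = refl

module InverseRelation {c ℓ} (F : Field c ℓ) where
  open Field F
  open QSeries F using (sumTo)
  open SumProperties F
  open import Relation.Binary.Reasoning.Setoid setoid

  infixl 7 _⊛_
  _⊛_ : (ℕ → ℕ → Carrier) → (ℕ → Carrier) → ℕ → Carrier
  (C ⊛ A) m = sumTo m (λ k → A (m ∸ k) * C m k)

  inverse-relation : ∀ (C D : ℕ → ℕ → Carrier) (A : ℕ → Carrier) r →
    C r 0 * D r 0 ≈ 1# →
    (∀ s → 1 ≤ s → s ≤ r → sumTo s (λ i → C (r ∸ i) (s ∸ i) * D r i) ≈ 0#) →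
    sumTo r (λ i → (C ⊛ A) (r ∸ i) * D r i) ≈ A r
  inverse-relation C D A r diagonal off-diagonal = begin
    sumTo r (λ i → (C ⊛ A) (r ∸ i) * D r i)
      ≈⟨ sumTo-cong r (λ i _ → *-distribʳ-sumTo (r ∸ i) (D r i) _) ⟩
    sumTo r (λ i → sumTo (r ∸ i) (λ k → A (r ∸ i ∸ k) * C (r ∸ i) k * D r i))
      ≈⟨ sumTo-triangle r (λ i k → A (r ∸ i ∸ k) * C (r ∸ i) k * D r i) ⟩
    sumTo r (λ s → sumTo s (λ i → A (r ∸ i ∸ (s ∸ i)) * C (r ∸ i) (s ∸ i) * D r i))
      ≈⟨ sumTo-cong r (λ s _ → factor-out s) ⟩
    sumTo r (λ s → A (r ∸ s) * sumTo s (λ i → C (r ∸ i) (s ∸ i) * D r i))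
      ≈⟨ sumTo≈head r _ (λ s 1≤s s≤r → trans (*-congˡ (off-diagonal s 1≤s s≤r)) (zeroʳ _)) ⟩
    A r * (C r 0 * D r 0)
      ≈⟨ *-congˡ diagonal ⟩
    A r * 1#
      ≈⟨ *-identityʳ _ ⟩
    A r ∎
    where
    r∸i∸[s∸i]≡r∸s : ∀ {s i} → i ≤ s → r ∸ i ∸ (s ∸ i) ≡.≡ r ∸ s
    r∸i∸[s∸i]≡r∸s {s} {i} i≤s = ≡.trans (ℕ.∸-+-assoc r i (s ∸ i)) (≡.cong (r ∸_) (ℕ.m+[n∸m]≡n i≤s))

    factor-out : ∀ s → sumTo s (λ i → A (r ∸ i ∸ (s ∸ i)) * C (r ∸ i) (s ∸ i) * D r i)
                       ≈ A (r ∸ s) * sumTo s (λ i → C (r ∸ i) (s ∸ i) * D r i)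
    factor-out s = begin
      sumTo s (λ i → A (r ∸ i ∸ (s ∸ i)) * C (r ∸ i) (s ∸ i) * D r i)
        ≈⟨ sumTo-cong s (λ i i≤s → trans (*-assoc _ _ _) (*-congʳ (reflexive (≡.cong A (r∸i∸[s∸i]≡r∸s i≤s))))) ⟩
      sumTo s (λ i → A (r ∸ s) * (C (r ∸ i) (s ∸ i) * D r i))
        ≈⟨ *-distribˡ-sumTo s (A (r ∸ s)) _ ⟨
      A (r ∸ s) * sumTo s (λ i → C (r ∸ i) (s ∸ i) * D r i) ∎

module PochhammerProperties {c ℓ} (F : Field c ℓ) where
  open Field F
  open QSeries F
  open FieldProperties F
  open IntegerRingSolver commutativeRing
  open import Relation.Binary.Reasoning.Setoid setoid

  NonZeroFactors : Carrier → Carrier → Set ℓ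
  NonZeroFactors q b = ∀ n → ¬ (1# - b * q ^ n ≈ 0#)

  ^-+ : ∀ y m n → y ^ (m +ℕ n) ≈ y ^ m * y ^ n
  ^-+ y zero    n = sym (*-identityˡ _)
  ^-+ y (suc m) n = trans (*-congˡ (^-+ y m n)) (sym (*-assoc _ _ _))

  *-^-+ : ∀ b y m n → b * y ^ (m +ℕ n) ≈ b * y ^ m * y ^ n
  *-^-+ b y m n = trans (*-congˡ (^-+ y m n)) (sym (*-assoc _ _ _))

  prodBelow-cong : ∀ k {f g : ℕ → Carrier} → (∀ j → f j ≈ g j) → prodBelow k f ≈ prodBelow k g
  prodBelow-cong zero    f≈g = refl
  prodBelow-cong (suc k) f≈g = *-cong (prodBelow-cong k f≈g) (f≈g k)

  prodBelow-+ : ∀ m n (f : ℕ → Carrier) → prodBelow (m +ℕ n) f ≈ prodBelow m f * prodBelow n (λ j → f (m +ℕ j))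
  prodBelow-+ m zero    f rewrite ℕ.+-identityʳ m = sym (*-identityʳ _)
  prodBelow-+ m (suc n) f rewrite ℕ.+-suc m n = begin
    prodBelow (m +ℕ n) f * f (m +ℕ n)                                   ≈⟨ *-congʳ (prodBelow-+ m n f) ⟩
    prodBelow m f * prodBelow n (λ j → f (m +ℕ j)) * f (m +ℕ n)          ≈⟨ *-assoc _ _ _ ⟩
    prodBelow m f * (prodBelow n (λ j → f (m +ℕ j)) * f (m +ℕ n))        ∎

  poch-cong : ∀ q {b b′} k → b ≈ b′ → poch q b k ≈ poch q b′ k
  poch-cong q k b≈b′ = prodBelow-cong k (λ j → +-congˡ (-‿cong (*-congʳ b≈b′)))

  poch-+ : ∀ q b m n → poch q b (m +ℕ n) ≈ poch q b m * poch q (b * q ^ m) n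
  poch-+ q b m n = trans (prodBelow-+ m n _) (*-congˡ (prodBelow-cong n (λ j → +-congˡ (-‿cong (*-^-+ b q m j)))))

  poch-sucˡ : ∀ q b n → poch q b (suc n) ≈ (1# - b) * poch q (b * q) n
  poch-sucˡ q b n = begin
    poch q b (1 +ℕ n)                          ≈⟨ poch-+ q b 1 n ⟩
    1# * (1# - b * (q ^ 0)) * poch q (b * q ^ 1) n ≈⟨ *-cong (trans (*-identityˡ _) (+-congˡ (-‿cong (*-identityʳ b))))
                                                          (poch-cong q n (*-congˡ (*-identityʳ q))) ⟩
    (1# - b) * poch q (b * q) n                  ∎

  NonZeroFactors-shift : ∀ {q b} → NonZeroFactors q b → ∀ m → NonZeroFactors q (b * q ^ m)
  NonZeroFactors-shift {q} {b} b-nz m n = ≉0-resp-≈ (+-congˡ (-‿cong (*-^-+ b q m n))) (b-nz (m +ℕ n))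

  poch≉0 : ∀ {q b} → NonZeroFactors q b → ∀ k → ¬ poch q b k ≈ 0#
  poch≉0 b-nz zero    1≈0 = 0≉1 (sym 1≈0)
  poch≉0 b-nz (suc k)     = x*y≉0 (poch≉0 b-nz k) (b-nz k)

  poch-ratio-+ : ∀ q a {b} → NonZeroFactors q b → ∀ m n →
    poch q a m / poch q b m * (poch q (a * q ^ m) n / poch q (b * q ^ m) n) ≈ poch q a (m +ℕ n) / poch q b (m +ℕ n)
  poch-ratio-+ q a {b} b-nz m n = begin
    poch q a m / poch q b m * (poch q (a * q ^ m) n / poch q (b * q ^ m) n)
      ≈⟨ /-*-/ _ _ (poch≉0 b-nz m) (poch≉0 (NonZeroFactors-shift b-nz m) n) ⟩
    poch q a m * poch q (a * q ^ m) n / (poch q b m * poch q (b * q ^ m) n)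
      ≈⟨ *-cong (poch-+ q a m n) (⁻¹-cong (poch-+ q b m n)) ⟨
    poch q a (m +ℕ n) / poch q b (m +ℕ n) ∎

  ^*poch-⁻¹ : ∀ q {x} → ¬ x ≈ 0# → ∀ k → x ^ k * poch q (x ⁻¹) k ≈ prodBelow k (λ j → x - q ^ j)
  ^*poch-⁻¹ q x≉0 zero    = *-identityˡ 1#
  ^*poch-⁻¹ q {x} x≉0 (suc k) = begin
    x * x ^ k * (poch q (x ⁻¹) k * (1# - x ⁻¹ * q ^ k)) ≈⟨ regroup x (x ⁻¹) (x ^ k) (poch q (x ⁻¹) k) (q ^ k) ⟩
    x ^ k * poch q (x ⁻¹) k * (x - x * x ⁻¹ * q ^ k)     ≈⟨ *-cong (^*poch-⁻¹ q x≉0 k)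
                                                               (+-congˡ (-‿cong (*-congʳ (⁻¹-inverse x x≉0)))) ⟩
    prodBelow k (λ j → x - q ^ j) * (x - 1# * q ^ k)     ≈⟨ *-congˡ (+-congˡ (-‿cong (*-identityˡ _))) ⟩
    prodBelow k (λ j → x - q ^ j) * (x - q ^ k)          ∎
    where
    regroup : ∀ x y a b z → x * a * (b * (1# - y * z)) ≈ a * b * (x - x * y * z)
    regroup = solve 5 (λ x y a b z → x :* a :* (b :* (𝟏 :- y :* z)) := a :* b :* (x :- x :* y :* z)) refl

module WellPoisedInversion {c ℓ} (F : Field c ℓ) where
  open Field F
  open QSeries F
  open FieldProperties F
  open SumProperties F
  open InverseRelation F
  open PochhammerProperties F
  open IntegerRingSolver commutativeRing
  open import Algebra.Properties.CommutativeSemigroup *-commutativeSemigroup using (xy∙z≈xz∙y; xy∙z≈yz∙x; x∙yz≈xz∙y)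
  open import Relation.Binary.Reasoning.Setoid setoid

  module WellPoisedSum (q x w : Carrier) (q-nz : NonZeroFactors q q) (w-nz : NonZeroFactors q w)
                       (xw-nz : NonZeroFactors q (x * w)) where
    Π : ℕ → Carrier
    Π k = prodBelow k (λ j → x - q ^ j)

    -- term n i (n ∸ i) is the i-th summand of the well-poised sum of length n.
    term : ℕ → ℕ → ℕ → Carrier
    term n i t = Π i / poch q q i
               * (poch q x t / poch q q t)
               * (poch q (w * q ^ suc t) n * (1# - x * w * q ^ (t +ℕ t)) / poch q (x * w * q ^ t) (suc n))
               * ((1# - w * q ^ (n +ℕ n)) / (1# - w * q ^ (n +ℕ t)))

    -- Closed form of κ n times the sum of the first p summands, evaluated at t = n ∸ p.
    partial : ℕ → ℕ → ℕ → Carrier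
    partial n p t = - (1# - w * q ^ (n +ℕ n))
                  * (Π p * (1# - q ^ p) / poch q q p)
                  * (poch q (x * q) t / poch q q t)
                  * (poch q (w * q ^ suc t) n / poch q (x * w * q ^ suc t) n)

    κ : ℕ → Carrier
    κ n = (1# - q ^ n) * (1# - w * q ^ n)

    poch-q≉0 : ∀ k → ¬ poch q q k ≈ 0#
    poch-q≉0 = poch≉0 q-nz

    poch-xwqᵐ≉0 : ∀ m k → ¬ poch q (x * w * q ^ m) k ≈ 0#
    poch-xwqᵐ≉0 m = poch≉0 (NonZeroFactors-shift xw-nz m)

    -- The polynomial identity behind the telescoping step, at A = q^p and B = q^(t+1).
    certificate : ∀ A B →
      - ((x - A) * (1# - B) * ((1# - w * B) * (1# - x * w * B * (A * B))))
        ≈ - ((1# - A) * (1# - x * B) * (1# - x * w * B)) * (1# - w * B * (A * B))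
          + (1# - A * B) * (1# - w * (A * B)) * (1# - x) * (1# - x * w * B * B)
    certificate = solve 4 (λ x w A B →
      :- ((x :- A) :* (𝟏 :- B) :* ((𝟏 :- w :* B) :* (𝟏 :- x :* w :* B :* (A :* B))))
        := :- ((𝟏 :- A) :* (𝟏 :- x :* B) :* (𝟏 :- x :* w :* B)) :* (𝟏 :- w :* B :* (A :* B))
           :+ (𝟏 :- A :* B) :* (𝟏 :- w :* (A :* B)) :* (𝟏 :- x) :* (𝟏 :- x :* w :* B :* B)) refl x w

    partial-0 : ∀ n t → partial n 0 t ≈ 0#
    partial-0 n t = vanish (1# - w * q ^ (n +ℕ n)) (1# ⁻¹) _ _
      where
      vanish : ∀ W i a b → - W * (1# * (1# - 1#) * i) * a * b ≈ 0#
      vanish = solve 4 (λ W i a b → :- W :* (𝟏 :* (𝟏 :- 𝟏) :* i) :* a :* b := 𝟎) refl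

    module _ {n : ℕ} (p t : ℕ) (p+1+t≡n : p +ℕ suc t ≡.≡ n) where
      private
        A B G W F₁ F₂ F₃ K P′ D′ E₁ E₂ E₃ : Carrier
        A  = q ^ p
        B  = q ^ suc t
        G  = 1# - w * B * (A * B)
        W  = 1# - w * q ^ (n +ℕ n)
        P′ = poch q (w * q ^ suc (suc t)) n
        D′ = poch q (x * w * B) (suc n)
        F₁ = Π p / poch q q p
        F₂ = poch q (x * q) t / poch q q (suc t)
        F₃ = P′ / D′
        K  = W * F₁ * F₂ * F₃
        E₁ = (x - A) * (1# - B) * ((1# - w * B) * (1# - x * w * B * (A * B)) / G)
        E₂ = (1# - A) * (1# - x * B) * (1# - x * w * B)
        E₃ = (1# - A * B) * (1# - w * (A * B)) * (1# - x) * (1# - x * w * B * B)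

        qⁿ≈AB : q ^ n ≈ A * B
        qⁿ≈AB = trans (reflexive (≡.cong (q ^_) (≡.sym p+1+t≡n))) (^-+ q p (suc t))

        G≉0 : ¬ G ≈ 0#
        G≉0 = ≉0-resp-≈ (+-congˡ (-‿cong (*-congˡ qⁿ≈AB))) (NonZeroFactors-shift w-nz (suc t) n)

        1-xwBAB≉0 : ¬ 1# - x * w * B * (A * B) ≈ 0#
        1-xwBAB≉0 = ≉0-resp-≈ (+-congˡ (-‿cong (*-congˡ qⁿ≈AB))) (NonZeroFactors-shift xw-nz (suc t) n)

        shift : ∀ y → y * B * q ≈ y * q ^ suc (suc t)
        shift y = trans (*-assoc y B q) (*-congˡ (*-comm B q))

        regroup : ∀ a b c d e₁ e₂ e₃ → - a * (b * e₁) * (c * e₂) * (d * e₃) ≈ a * b * c * d * - (e₁ * e₂ * e₃)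
        regroup = solve 7 (λ a b c d e₁ e₂ e₃ →
          :- a :* (b :* e₁) :* (c :* e₂) :* (d :* e₃) := a :* b :* c :* d :* :- (e₁ :* e₂ :* e₃)) refl

      partial-suc-factored : partial n (suc p) t ≈ K * - E₁
      partial-suc-factored = trans (*-cong (*-cong (*-congˡ factor₁) factor₂) factor₃) (regroup _ _ _ _ _ _ _)
        where
        factor₁ : Π (suc p) * (1# - q ^ suc p) / poch q q (suc p) ≈ F₁ * (x - A)
        factor₁ = begin
          Π p * (x - A) * (1# - q ^ suc p) * poch q q (suc p) ⁻¹  ≈⟨ *-assoc _ _ _ ⟩
          Π p * (x - A) * ((1# - q ^ suc p) / poch q q (suc p))   ≈⟨ *-congˡ (x*y≈z⇒x⁻¹≈y/z (poch-q≉0 p) (q-nz p) refl) ⟨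
          Π p * (x - A) * poch q q p ⁻¹                           ≈⟨ xy∙z≈xz∙y _ _ _ ⟩
          F₁ * (x - A)                                            ∎

        factor₂ : poch q (x * q) t / poch q q t ≈ F₂ * (1# - B)
        factor₂ = trans (*-congˡ (x*y≈z⇒x⁻¹≈y/z (poch-q≉0 t) (q-nz t) refl)) (x∙yz≈xz∙y _ _ _)

        factor₃ : poch q (w * B) n / poch q (x * w * B) n ≈ F₃ * ((1# - w * B) * (1# - x * w * B * (A * B)) / G)
        factor₃ = trans (*-cong numerator denominator) (regroup₃ _ _ _ _ _)
          where
          numerator : poch q (w * B) n ≈ (1# - w * B) * P′ / G
          numerator = x*y≈z⇒x≈z/y G≉0 (begin
            poch q (w * B) n * G                 ≈⟨ *-congˡ (+-congˡ (-‿cong (*-congˡ qⁿ≈AB))) ⟨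
            poch q (w * B) (suc n)               ≈⟨ poch-sucˡ q (w * B) n ⟩
            (1# - w * B) * poch q (w * B * q) n  ≈⟨ *-congˡ (poch-cong q n (shift w)) ⟩
            (1# - w * B) * P′                    ∎)

          denominator : poch q (x * w * B) n ⁻¹ ≈ (1# - x * w * B * (A * B)) / D′
          denominator = x*y≈z⇒x⁻¹≈y/z (poch-xwqᵐ≉0 (suc t) n) 1-xwBAB≉0
                          (*-congˡ (+-congˡ (-‿cong (*-congˡ (sym qⁿ≈AB)))))

          regroup₃ : ∀ a b m g d → a * m * g * (b * d) ≈ m * d * (a * b * g)
          regroup₃ = solve 5 (λ a b m g d → a :* m :* g :* (b :* d) := m :* d :* (a :* b :* g)) refl

      partial-factored : partial n p (suc t) ≈ K * - E₂
      partial-factored = trans (*-cong (*-cong (*-congˡ (xy∙z≈xz∙y _ _ _)) factor₂) factor₃) (regroup _ _ _ _ _ _ _)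
        where
        factor₂ : poch q (x * q) (suc t) / poch q q (suc t) ≈ F₂ * (1# - x * B)
        factor₂ = trans (*-congʳ (*-congˡ (+-congˡ (-‿cong (*-assoc x q (q ^ t)))))) (xy∙z≈xz∙y _ _ _)

        factor₃ : P′ / poch q (x * w * q ^ suc (suc t)) n ≈ F₃ * (1# - x * w * B)
        factor₃ = trans (*-congˡ (x*y≈z⇒x⁻¹≈y/z (poch-xwqᵐ≉0 (suc (suc t)) n) (xw-nz (suc t)) (begin
          poch q (x * w * q ^ suc (suc t)) n * (1# - x * w * B)  ≈⟨ *-comm _ _ ⟩
          (1# - x * w * B) * poch q (x * w * q ^ suc (suc t)) n  ≈⟨ *-congˡ (poch-cong q n (shift (x * w))) ⟨
          (1# - x * w * B) * poch q (x * w * B * q) n            ≈⟨ poch-sucˡ q (x * w * B) n ⟨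
          D′                                                     ∎))) (x∙yz≈xz∙y _ _ _)

      κ*term-factored : κ n * term n p (suc t) ≈ K * (E₃ / G)
      κ*term-factored = trans (*-cong κ≈ (*-cong (*-cong (*-congˡ factor₂) factor₃) factor₄)) (regroupᶜ _ _ _ _ _ _ _ _ _)
        where
        κ≈ : κ n ≈ (1# - A * B) * (1# - w * (A * B))
        κ≈ = *-cong (+-congˡ (-‿cong qⁿ≈AB)) (+-congˡ (-‿cong (*-congˡ qⁿ≈AB)))

        factor₂ : poch q x (suc t) / poch q q (suc t) ≈ F₂ * (1# - x)
        factor₂ = trans (*-congʳ (poch-sucˡ q x t)) (xy∙z≈yz∙x _ _ _)

        factor₃ : P′ * (1# - x * w * q ^ (suc t +ℕ suc t)) / D′ ≈ F₃ * (1# - x * w * B * B)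
        factor₃ = trans (*-congʳ (*-congˡ (+-congˡ (-‿cong (*-^-+ (x * w) q (suc t) (suc t)))))) (xy∙z≈xz∙y _ _ _)

        factor₄ : W / (1# - w * q ^ (n +ℕ suc t)) ≈ W / G
        factor₄ = *-congˡ (⁻¹-cong (+-congˡ (-‿cong (begin
          w * q ^ (n +ℕ suc t)  ≈⟨ *-^-+ w q n (suc t) ⟩
          w * q ^ n * B          ≈⟨ *-congʳ (*-congˡ qⁿ≈AB) ⟩
          w * (A * B) * B        ≈⟨ xy∙z≈xz∙y _ _ _ ⟩
          w * B * (A * B)        ∎))))

        regroupᶜ : ∀ k₁ k₂ a b c d e₁ e₂ g →
                   k₁ * k₂ * (b * (c * e₁) * (d * e₂) * (a * g)) ≈ a * b * c * d * (k₁ * k₂ * e₁ * e₂ * g)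
        regroupᶜ = solve 9 (λ k₁ k₂ a b c d e₁ e₂ g →
          k₁ :* k₂ :* (b :* (c :* e₁) :* (d :* e₂) :* (a :* g)) := a :* b :* c :* d :* (k₁ :* k₂ :* e₁ :* e₂ :* g)) refl

      telescoping-step : partial n (suc p) t ≈ partial n p (suc t) + κ n * term n p (suc t)
      telescoping-step = begin
        partial n (suc p) t                           ≈⟨ partial-suc-factored ⟩
        K * - E₁                                      ≈⟨ *-congˡ (trans (pull-/ _ _ _) (x≈y*z+w⇒x/z≈y+w/z G≉0 (certificate A B))) ⟩
        K * (- E₂ + E₃ / G)                           ≈⟨ distribˡ _ _ _ ⟩
        K * - E₂ + K * (E₃ / G)                       ≈⟨ +-cong partial-factored κ*term-factored ⟨
        partial n p (suc t) + κ n * term n p (suc t)  ∎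
        where
        pull-/ : ∀ a b g → - (a * (b * g)) ≈ - (a * b) * g
        pull-/ = solve 3 (λ a b g → :- (a :* (b :* g)) := :- (a :* b) :* g) refl

    partial+κ*term≈0 : ∀ n → partial n n 0 + κ n * term n n 0 ≈ 0#
    partial+κ*term≈0 n = begin
      partial n n 0 + κ n * term n n 0              ≈⟨ +-congˡ κ*term≈ ⟩
      partial n n 0 + Y * (h * h ⁻¹)                ≈⟨ +-congˡ (*-congˡ (⁻¹-inverse h (w-nz n))) ⟩
      partial n n 0 + Y * 1#                        ≈⟨ cancel _ _ _ _ ⟩
      0#                                            ∎
      where
      W h P₁ D₁ Y : Carrier
      W  = 1# - w * q ^ (n +ℕ n)
      h  = 1# - w * q ^ n
      P₁ = poch q (w * q ^ 1) n
      D₁ = poch q (x * w * q ^ 1) n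
      Y  = W * (Π n * (1# - q ^ n) / poch q q n) * (1# / 1#) * (P₁ / D₁)

      shift : x * w * q ^ 0 * q ≈ x * w * q ^ 1
      shift = trans (*-assoc _ _ _) (*-congˡ (*-comm _ _))

      factor₃ : P₁ * (1# - x * w * q ^ 0) / poch q (x * w * q ^ 0) (suc n) ≈ P₁ / D₁
      factor₃ = trans (*-assoc _ _ _) (*-congˡ (sym (x*y≈z⇒x⁻¹≈y/z (poch-xwqᵐ≉0 1 n) (xw-nz 0) (begin
        D₁ * (1# - x * w * q ^ 0)                            ≈⟨ *-comm _ _ ⟩
        (1# - x * w * q ^ 0) * D₁                            ≈⟨ *-congˡ (poch-cong q n shift) ⟨
        (1# - x * w * q ^ 0) * poch q (x * w * q ^ 0 * q) n  ≈⟨ poch-sucˡ q _ n ⟨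
        poch q (x * w * q ^ 0) (suc n)                       ∎))))

      factor₄ : W / (1# - w * q ^ (n +ℕ 0)) ≈ W / h
      factor₄ = reflexive (≡.cong (λ k → W / (1# - w * q ^ k)) (ℕ.+-identityʳ n))

      κ*term≈ : κ n * term n n 0 ≈ Y * (h * h ⁻¹)
      κ*term≈ = trans (*-congˡ (*-cong (*-congˡ factor₃) factor₄)) (regroup _ _ _ _ _ _ _ _)
        where
        regroup : ∀ a h π i u r W g → a * h * (π * i * u * r * (W * g)) ≈ W * (π * a * i) * u * r * (h * g)
        regroup = solve 8 (λ a h π i u r W g →
          a :* h :* (π :* i :* u :* r :* (W :* g)) := W :* (π :* a :* i) :* u :* r :* (h :* g)) refl

      cancel : ∀ W g u v → - W * g * u * v + W * g * u * v * 1# ≈ 0#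
      cancel = solve 4 (λ W g u v → :- W :* g :* u :* v :+ W :* g :* u :* v :* 𝟏 := 𝟎) refl

    sum-vanishes : ∀ m → sumTo (suc m) (λ i → term (suc m) i (suc m ∸ i)) ≈ 0#
    sum-vanishes m = x*y≈0⇒y≈0 (x*y≉0 (q-nz m) (w-nz n)) (begin
      κ n * sumTo n τ
        ≈⟨ *-distribˡ-sumTo n (κ n) τ ⟩
      sumTo m (λ i → κ n * τ i) + κ n * τ n
        ≈⟨ +-congʳ (sumTo-telescope f (λ i → κ n * τ i) (partial-0 n n) step m (ℕ.n<1+n m)) ⟩
      partial n n (m ∸ m) + κ n * τ n
        ≡⟨ ≡.cong (λ k → partial n n k + κ n * term n n k) (ℕ.n∸n≡0 m) ⟩
      partial n n 0 + κ n * term n n 0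
        ≈⟨ partial+κ*term≈0 n ⟩
      0# ∎)
      where
      n : ℕ
      n = suc m

      τ f : ℕ → Carrier
      τ i = term n i (n ∸ i)
      f p = partial n p (n ∸ p)

      step : ∀ p → p < n → f (suc p) ≈ f p + κ n * τ p
      step p p<n = ≡.subst (λ k → partial n (suc p) t ≈ partial n p k + κ n * term n p k)
                           (≡.sym n∸p≡1+t) (telescoping-step p t p+1+t≡n)
        where
        t : ℕ
        t = n ∸ suc p
        p+1+t≡n : p +ℕ suc t ≡.≡ n
        p+1+t≡n = ≡.trans (ℕ.+-suc p t) (ℕ.m+[n∸m]≡n p<n)
        n∸p≡1+t : n ∸ p ≡.≡ suc t
        n∸p≡1+t = ≡.trans (≡.cong (_∸ p) (≡.sym p+1+t≡n)) (ℕ.m+n∸m≡n p (suc t))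

  module InversePair (q a u v x : Carrier) (g : Generic q a u v x) where
    open Generic g

    A : ℕ → Carrier
    A j = a ^ j * (poch q u j / poch q q j) * Φ q a v j

    -- C and D with their q-exponents as parameters, so that these can be rewritten along equations in ℕ.
    C′ : (k e₁ e₂ : ℕ) → Carrier
    C′ k e₁ e₂ = (poch q x k / poch q q k)
               * (poch q (u * q ^ e₁) k / poch q (v * q ^ suc e₁) k)
               * (poch q (v ^ 2 * q ^ suc e₂) k / poch q (x * v ^ 2 * q ^ e₂) k)

    C : ℕ → ℕ → Carrier
    C m k = C′ k (m ∸ k) ((2 *ℕ m) ∸ k)

    D′ : (i e₁ e₂ e₃ e₄ : ℕ) → Carrier
    D′ i e₁ e₂ e₃ e₄ = x ^ i
                     * (poch q (x ⁻¹) i / poch q q i)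
                     * (poch q (u * q ^ e₁) i / poch q (v * q ^ suc e₁) i)
                     * (poch q (v ^ 2 * q ^ suc e₂) i / poch q (x * v ^ 2 * q ^ suc e₂) i)
                     * ((1# - v ^ 2 * q ^ e₃) / (1# - v ^ 2 * q ^ e₄))

    D : ℕ → ℕ → Carrier
    D r i = D′ i (r ∸ i) ((2 *ℕ r) ∸ (2 *ℕ i)) (2 *ℕ r) ((2 *ℕ r) ∸ i)

    C′-≡ : ∀ {k k′ e₁ e₁′ e₂ e₂′} → k ≡.≡ k′ → e₁ ≡.≡ e₁′ → e₂ ≡.≡ e₂′ → C′ k e₁ e₂ ≡.≡ C′ k′ e₁′ e₂′
    C′-≡ ≡.refl ≡.refl ≡.refl = ≡.refl

    D′-≡ : ∀ {i e₁ e₁′ e₂ e₂′ e₃ e₃′ e₄ e₄′} → e₁ ≡.≡ e₁′ → e₂ ≡.≡ e₂′ → e₃ ≡.≡ e₃′ → e₄ ≡.≡ e₄′ →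
           D′ i e₁ e₂ e₃ e₄ ≡.≡ D′ i e₁′ e₂′ e₃′ e₄′
    D′-≡ ≡.refl ≡.refl ≡.refl ≡.refl = ≡.refl

    q-nz : NonZeroFactors q q
    q-nz n 1-qⁿ⁺¹≈0 = qⁿ≉1 n (1-x≈0⇒x≈1 1-qⁿ⁺¹≈0)

    -- For j = r ∸ s, the (s, i) term of C·D is U s times a term of the well-poised sum with w = v²q^{2j}.
    module _ (j : ℕ) where
      private
        jj : ℕ
        jj = j +ℕ j

      w : Carrier
      w = v ^ 2 * q ^ jj

      w-nz : NonZeroFactors q w
      w-nz = NonZeroFactors-shift v²qⁿ jj

      xw-nz : NonZeroFactors q (x * w)
      xw-nz n = ≉0-resp-≈ (+-congˡ (-‿cong (*-congʳ (*-assoc x (v ^ 2) (q ^ jj))))) (NonZeroFactors-shift xv²qⁿ jj n)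

      open WellPoisedSum q x w q-nz w-nz xw-nz public using (term; sum-vanishes)

      U : ℕ → Carrier
      U s = poch q (u * q ^ j) s / poch q (v * q ^ suc j) s

      private
        v²-shift : ∀ e → v ^ 2 * q ^ (jj +ℕ e) ≈ w * q ^ e
        v²-shift = *-^-+ (v ^ 2) q jj

        xv²-shift : ∀ e → x * v ^ 2 * q ^ (jj +ℕ e) ≈ x * w * q ^ e
        xv²-shift e = trans (*-^-+ (x * v ^ 2) q jj e) (*-congʳ (*-assoc x (v ^ 2) (q ^ jj)))

        suc-inside : ∀ b e → b * q ^ suc (jj +ℕ e) ≈ b * q ^ (jj +ℕ suc e)
        suc-inside b e = reflexive (≡.cong (λ k → b * q ^ k) (≡.sym (ℕ.+-suc jj e)))

        poch-xwqᵐ≉0 : ∀ m k → ¬ poch q (x * w * q ^ m) k ≈ 0#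
        poch-xwqᵐ≉0 m = poch≉0 (NonZeroFactors-shift xw-nz m)

      x-factor : ∀ i → x ^ i * (poch q (x ⁻¹) i / poch q q i) ≈ prodBelow i (λ k → x - q ^ k) / poch q q i
      x-factor i = trans (sym (*-assoc _ _ _)) (*-congʳ (^*poch-⁻¹ q x≉0 i))

      u-factor : ∀ t i → poch q (u * q ^ j) t / poch q (v * q ^ suc j) t
                         * (poch q (u * q ^ (j +ℕ t)) i / poch q (v * q ^ suc (j +ℕ t)) i)
                       ≈ U (t +ℕ i)
      u-factor t i = trans (*-congˡ (*-cong (poch-cong q i (*-^-+ u q j t))
                                            (⁻¹-cong (poch-cong q i (*-^-+ v q (suc j) t)))))
                           (poch-ratio-+ q (u * q ^ j) (NonZeroFactors-shift vqⁿ (suc j)) t i)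

      w-factor : ∀ t i →
        poch q (v ^ 2 * q ^ suc (jj +ℕ t)) t / poch q (x * v ^ 2 * q ^ (jj +ℕ t)) t
          * (poch q (v ^ 2 * q ^ suc (jj +ℕ (t +ℕ t))) i / poch q (x * v ^ 2 * q ^ suc (jj +ℕ (t +ℕ t))) i)
        ≈ poch q (w * q ^ suc t) (t +ℕ i) * (1# - x * w * q ^ (t +ℕ t)) / poch q (x * w * q ^ t) (suc (t +ℕ i))
      w-factor t i = begin
        _ ≈⟨ *-cong (*-cong (poch-cong q t (trans (suc-inside _ t) (v²-shift (suc t))))
                            (⁻¹-cong (poch-cong q t (xv²-shift t))))
                    (*-cong (poch-cong q i (trans (suc-inside _ (t +ℕ t)) (v²-shift _)))
                            (⁻¹-cong (poch-cong q i (trans (suc-inside _ (t +ℕ t)) (xv²-shift _))))) ⟩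
        poch q (w * q ^ suc t) t / poch q (x * w * q ^ t) t
          * (poch q (w * q ^ suc (t +ℕ t)) i / poch q (x * w * q ^ suc (t +ℕ t)) i)
            ≈⟨ /-*-/ _ _ (poch-xwqᵐ≉0 t t) (poch-xwqᵐ≉0 (suc (t +ℕ t)) i) ⟩
        poch q (w * q ^ suc t) t * poch q (w * q ^ suc (t +ℕ t)) i
          / (poch q (x * w * q ^ t) t * poch q (x * w * q ^ suc (t +ℕ t)) i)
            ≈⟨ *-cong numerator denominator ⟩
        poch q (w * q ^ suc t) (t +ℕ i) * ((1# - x * w * q ^ (t +ℕ t)) / poch q (x * w * q ^ t) (suc (t +ℕ i)))
            ≈⟨ *-assoc _ _ _ ⟨
        poch q (w * q ^ suc t) (t +ℕ i) * (1# - x * w * q ^ (t +ℕ t)) / poch q (x * w * q ^ t) (suc (t +ℕ i)) ∎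
        where
        numerator : poch q (w * q ^ suc t) t * poch q (w * q ^ suc (t +ℕ t)) i ≈ poch q (w * q ^ suc t) (t +ℕ i)
        numerator = sym (trans (poch-+ q _ t i) (*-congˡ (poch-cong q i (sym (*-^-+ w q (suc t) t)))))

        denominator : (poch q (x * w * q ^ t) t * poch q (x * w * q ^ suc (t +ℕ t)) i) ⁻¹
                    ≈ (1# - x * w * q ^ (t +ℕ t)) / poch q (x * w * q ^ t) (suc (t +ℕ i))
        denominator = x*y≈z⇒x⁻¹≈y/z (x*y≉0 (poch-xwqᵐ≉0 t t) (poch-xwqᵐ≉0 (suc (t +ℕ t)) i)) (xw-nz (t +ℕ t)) (begin
          poch q (x * w * q ^ t) t * poch q (x * w * q ^ suc (t +ℕ t)) i * (1# - x * w * q ^ (t +ℕ t))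
            ≈⟨ xy∙z≈xz∙y _ _ _ ⟩
          poch q (x * w * q ^ t) t * (1# - x * w * q ^ (t +ℕ t)) * poch q (x * w * q ^ suc (t +ℕ t)) i
            ≈⟨ *-cong (*-congˡ (+-congˡ (-‿cong (*-^-+ (x * w) q t t)))) (poch-cong q i shift) ⟩
          poch q (x * w * q ^ t) (suc t) * poch q (x * w * q ^ t * q ^ suc t) i
            ≈⟨ poch-+ q (x * w * q ^ t) (suc t) i ⟨
          poch q (x * w * q ^ t) (suc (t +ℕ i)) ∎)
          where
          shift : x * w * q ^ suc (t +ℕ t) ≈ x * w * q ^ t * q ^ suc t
          shift = trans (reflexive (≡.cong (λ k → x * w * q ^ k) (≡.sym (ℕ.+-suc t t)))) (*-^-+ (x * w) q t (suc t))

      C′D′≈U*term : ∀ t i → let s = t +ℕ i in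
        C′ t j (jj +ℕ t) * D′ i (j +ℕ t) (jj +ℕ (t +ℕ t)) (jj +ℕ (s +ℕ s)) (jj +ℕ (s +ℕ t)) ≈ U s * term s i t
      C′D′≈U*term t i = trans (regroup _ _ _ _ _ _ _ _)
        (*-cong (u-factor t i) (*-cong (*-cong (*-congʳ (x-factor i)) (w-factor t i))
                                       (*-cong (+-congˡ (-‿cong (v²-shift _))) (⁻¹-cong (+-congˡ (-‿cong (v²-shift _)))))))
        where
        regroup : ∀ a₁ u₁ w₁ y a₂ u₂ w₂ r → a₁ * u₁ * w₁ * (y * a₂ * u₂ * w₂ * r) ≈ u₁ * u₂ * (y * a₂ * a₁ * (w₁ * w₂) * r)
        regroup = solve 8 (λ a₁ u₁ w₁ y a₂ u₂ w₂ r →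
          a₁ :* u₁ :* w₁ :* (y :* a₂ :* u₂ :* w₂ :* r) := u₁ :* u₂ :* (y :* a₂ :* a₁ :* (w₁ :* w₂) :* r)) refl

      C*D≈U*term : ∀ t i → C (j +ℕ (t +ℕ i) ∸ i) (t +ℕ i ∸ i) * D (j +ℕ (t +ℕ i)) i ≈ U (t +ℕ i) * term (t +ℕ i) i t
      C*D≈U*term t i =
        trans (reflexive (≡.cong₂ _*_ (C′-≡ k≡ m∸k≡ 2m∸k≡) (D′-≡ {i} m≡ 2r∸2i≡ 2r≡ 2r∸i≡))) (C′D′≈U*term t i)
        where
        m≡n+o⇒m∸o≡n : ∀ {m n o} → m ≡.≡ n +ℕ o → m ∸ o ≡.≡ n
        m≡n+o⇒m∸o≡n {n = n} {o} m≡n+o = ≡.trans (≡.cong (_∸ o) m≡n+o) (ℕ.m+n∸n≡m n o)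

        k≡ : t +ℕ i ∸ i ≡.≡ t
        k≡ = ℕ.m+n∸n≡m t i
        m≡ : j +ℕ (t +ℕ i) ∸ i ≡.≡ j +ℕ t
        m≡ = m≡n+o⇒m∸o≡n (≡.sym (ℕ.+-assoc j t i))
        m∸k≡ : j +ℕ (t +ℕ i) ∸ i ∸ (t +ℕ i ∸ i) ≡.≡ j
        m∸k≡ = ≡.trans (≡.cong₂ _∸_ m≡ k≡) (ℕ.m+n∸n≡m j t)
        2m∸k≡ : 2 *ℕ (j +ℕ (t +ℕ i) ∸ i) ∸ (t +ℕ i ∸ i) ≡.≡ jj +ℕ t
        2m∸k≡ = ≡.trans (≡.cong₂ (λ m k → 2 *ℕ m ∸ k) m≡ k≡) (m≡n+o⇒m∸o≡n (lemma j t))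
          where lemma : ∀ j t → 2 *ℕ (j +ℕ t) ≡.≡ j +ℕ j +ℕ t +ℕ t
                lemma = solve-∀
        2r∸2i≡ : 2 *ℕ (j +ℕ (t +ℕ i)) ∸ 2 *ℕ i ≡.≡ jj +ℕ (t +ℕ t)
        2r∸2i≡ = m≡n+o⇒m∸o≡n (lemma j t i)
          where lemma : ∀ j t i → 2 *ℕ (j +ℕ (t +ℕ i)) ≡.≡ j +ℕ j +ℕ (t +ℕ t) +ℕ 2 *ℕ i
                lemma = solve-∀
        2r≡ : 2 *ℕ (j +ℕ (t +ℕ i)) ≡.≡ jj +ℕ ((t +ℕ i) +ℕ (t +ℕ i))
        2r≡ = lemma j t i
          where lemma : ∀ j t i → 2 *ℕ (j +ℕ (t +ℕ i)) ≡.≡ j +ℕ j +ℕ ((t +ℕ i) +ℕ (t +ℕ i))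
                lemma = solve-∀
        2r∸i≡ : 2 *ℕ (j +ℕ (t +ℕ i)) ∸ i ≡.≡ jj +ℕ ((t +ℕ i) +ℕ t)
        2r∸i≡ = m≡n+o⇒m∸o≡n (lemma j t i)
          where lemma : ∀ j t i → 2 *ℕ (j +ℕ (t +ℕ i)) ≡.≡ j +ℕ j +ℕ ((t +ℕ i) +ℕ t) +ℕ i
                lemma = solve-∀

    off-diagonal : ∀ r s → 1 ≤ s → s ≤ r → sumTo s (λ i → C (r ∸ i) (s ∸ i) * D r i) ≈ 0#
    off-diagonal r (suc m) _ s≤r =
      ≡.subst (λ r → sumTo s (λ i → C (r ∸ i) (s ∸ i) * D r i) ≈ 0#) (ℕ.m∸n+n≡m s≤r) (vanishes (r ∸ s))
      where
      s : ℕ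
      s = suc m

      vanishes : ∀ j → sumTo s (λ i → C (j +ℕ s ∸ i) (s ∸ i) * D (j +ℕ s) i) ≈ 0#
      vanishes j = begin
        sumTo s (λ i → C (j +ℕ s ∸ i) (s ∸ i) * D (j +ℕ s) i) ≈⟨ sumTo-cong s C*D≈ ⟩
        sumTo s (λ i → U j s * term j s i (s ∸ i))             ≈⟨ *-distribˡ-sumTo s (U j s) _ ⟨
        U j s * sumTo s (λ i → term j s i (s ∸ i))             ≈⟨ *-congˡ (sum-vanishes j m) ⟩
        U j s * 0#                                             ≈⟨ zeroʳ _ ⟩
        0#                                                     ∎
        where
        C*D≈ : ∀ i → i ≤ s → C (j +ℕ s ∸ i) (s ∸ i) * D (j +ℕ s) i ≈ U j s * term j s i (s ∸ i)
        C*D≈ i i≤s = ≡.subst (λ s′ → C (j +ℕ s′ ∸ i) (s′ ∸ i) * D (j +ℕ s′) i ≈ U j s′ * term j s′ i (s ∸ i))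
                             (ℕ.m∸n+n≡m i≤s) (C*D≈U*term j (s ∸ i) i)

    diagonal : ∀ r → C r 0 * D r 0 ≈ 1#
    diagonal r = trans (*-cong C≈1 D≈1) (*-identityʳ 1#)
      where
      1/1≈1 : 1# / 1# ≈ 1#
      1/1≈1 = trans (*-identityˡ _) 1⁻¹≈1
      C≈1 : C r 0 ≈ 1#
      C≈1 = trans (*-cong (*-cong 1/1≈1 1/1≈1) 1/1≈1) (trans (*-identityʳ _) (*-identityʳ _))
      D≈1 : D r 0 ≈ 1#
      D≈1 = trans (*-cong (*-cong (*-cong (*-congˡ 1/1≈1) 1/1≈1) 1/1≈1) (⁻¹-inverse _ (v²qⁿ (2 *ℕ r))))
                  (trans (*-identityʳ _) (trans (*-identityʳ _) (trans (*-identityʳ _) (*-identityʳ _))))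

    S≈C⊛A : ∀ m → S q a u v x m ≈ (C ⊛ A) m
    S≈C⊛A m = sumTo-cong m (λ _ _ → trans (*-congʳ (*-assoc _ _ _)) (*-assoc _ _ _))

    summand-factorises : ∀ m d₁ d₂ d₃ d₄ d₅ →
      poch q u m / poch q q m * H q a u v x m * d₁ * d₂ * d₃ * d₄ * d₅ ≈ (C ⊛ A) m * (d₁ * d₂ * d₃ * d₄ * d₅)
    summand-factorises m d₁ d₂ d₃ d₄ d₅ =
      trans (regroup _ _ _ _ _ _ _) (*-congʳ (trans (x*[y/x]≈y _ [u]/[q]≉0) (S≈C⊛A m)))
      where
      [u]/[q]≉0 : ¬ poch q u m / poch q q m ≈ 0#
      [u]/[q]≉0 = x*y≉0 (poch≉0 uqⁿ m) (x⁻¹≉0 (poch≉0 q-nz m))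

      regroup : ∀ a b c d e f g → a * b * c * d * e * f * g ≈ a * b * (c * d * e * f * g)
      regroup = solve 7 (λ a b c d e f g → a :* b :* c :* d :* e :* f :* g := a :* b :* (c :* d :* e :* f :* g)) refl

theorem3 : ∀ {c ℓ : Level} (F : Field c ℓ) →
    let open Field F
        open QSeries F
    in ∀ (q a u v x : Carrier) → Generic q a u v x → ∀ (r : ℕ) →
      a ^ r * (poch q u r / poch q q r) * Φ q a v r
        ≈ sumTo r (λ i →
            (poch q u (r ∸ i) / poch q q (r ∸ i)) * H q a u v x (r ∸ i)
            * x ^ i
            * (poch q (x ⁻¹) i / poch q q i)
            * (poch q (u * q ^ (r ∸ i)) i / poch q (v * q ^ suc (r ∸ i)) i)
            * (poch q (v ^ 2 * q ^ suc ((2 *ℕ r) ∸ (2 *ℕ i))) i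
                / poch q (x * v ^ 2 * q ^ suc ((2 *ℕ r) ∸ (2 *ℕ i))) i)
            * ((1# - v ^ 2 * q ^ (2 *ℕ r)) / (1# - v ^ 2 * q ^ ((2 *ℕ r) ∸ i))))
theorem3 F q a u v x g r = begin
    A r                                        ≈⟨ inverse-relation C D A r (diagonal r) (off-diagonal r) ⟨
    sumTo r (λ i → (C ⊛ A) (r ∸ i) * D r i)    ≈⟨ sumTo-cong r (λ i _ → summand-factorises (r ∸ i) _ _ _ _ _) ⟨
    sumTo r _                                  ∎
  where
  open Field F
  open QSeries F
  open SumProperties F
  open InverseRelation F
  open WellPoisedInversion.InversePair F q a u v x g
  open import Relation.Binary.Reasoning.Setoid setoid
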